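{- Let $m\ge2$ be an integer. For every $j\ge 0$, every $v\in\{0,1,\dots,m\}$ and every $r$ with $1\le r\le m-1$, $$sp(m^j(mv+r),m)=2v+1.$$
   Context: For fixed $m>1$, $sp(n,m)$ is defined by: $sp(n,m)=0$ for $n<0$, $sp(0,m)=1$, $sp(n,m)=1$ for $1\le n\le m-1$, and for $n\ge m$: $sp(n,m)=sp(n/m,m)$ if $m\mid n$, and $sp(n,m)=2sp(n-r,m)+sp(n-m,m)$ if $n\equiv r\pmod m$ with $0<r<m$. (It counts semi-$m$-Pell compositions of $n$.) -}

module Defs where

open import Data.Nat using (ℕ; zero; suc; _+_; _*_; _∸_; _<_; _≤_; _<ᵇ_)
open import Data.Nat.DivMod using (_/_; _%_)
open import Data.Nat.Properties using (_<?_)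
open import Data.Bool using (Bool; true; false; if_then_else_)
open import Relation.Nullary using (yes; no)

-- sp(n,m) for natural n (the paper sets sp(n,m)=0 for n<0; this case never
-- arises below because every recursive call has a nonnegative argument).
-- Defined by fuel-bounded recursion: every recursive call strictly decreases
-- n (n/m < n for n ≥ m ≥ 2, n-r < n for r > 0, n-m < n), so fuel (suc n)
-- always suffices; the fallback value 0 is never reached for m ≥ 2.
spFuel : ℕ → ℕ → (m : ℕ) → .{{_ : Data.Nat.NonZero m}} → ℕ
spFuel zero    n m = 0
spFuel (suc k) zero m = 1
spFuel (suc k) n@(suc _) m with n <? m
... | yes _ = 1
... | no _ with n % m
...   | zero = spFuel k (n / m) m
...   | r@(suc _) = 2 * spFuel k (n ∸ r) m + spFuel k (n ∸ m) m

sp : ℕ → (m : ℕ) → .{{_ : Data.Nat.NonZero m}} → ℕ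
sp n m = spFuel (suc n) n m

-- Multiplying by m does not change sp, so it suffices to treat n = m v + r.
-- For v ≥ 1 the recurrence gives sp (m v + r) = 2 sp (m v) + sp (m (v - 1) + r),
-- and sp (m v) = sp v = 1 as long as v ≤ m; hence sp grows by exactly 2 per step of v.
module Submission where

open import Defs
open import Relation.Binary.PropositionalEquality using (_≡_)
open import Data.Nat using (ℕ; suc; _+_; _*_; _^_; _≤_; _<_; NonZero)
open import Data.Nat using (zero; _∸_; s≤s; _<?_; >-nonZero⁻¹)
open import Data.Nat.Properties
open import Data.Nat.DivMod
open import Data.Sum using (inj₁; inj₂)
open import Relation.Binary.PropositionalEquality using (refl; cong; cong₂; sym; trans; module ≡-Reasoning)
open import Relation.Nullary using (yes; no; contradiction)

module SemiPell (m : ℕ) .{{_ : NonZero m}} (2≤m : 2 ≤ m) where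

  0<m : 0 < m
  0<m = >-nonZero⁻¹ m

  ∸-<-suc : ∀ n x → 0 < x → suc n ∸ x < suc n
  ∸-<-suc n (suc x) _ = s≤s (m∸n≤m n x)

  spFuel-irrelevant : ∀ {k k′} n → n < k → n < k′ → spFuel k n m ≡ spFuel k′ n m
  spFuel-irrelevant {suc _} {suc _} zero _ _ = refl
  spFuel-irrelevant {suc k} {suc k′} n@(suc n-1) (s≤s n≤k) (s≤s n≤k′) with n <? m
  ... | yes _ = refl
  ... | no _ with n % m
  ...   | zero = spFuel-irrelevant (n / m) (<-≤-trans n/m<n n≤k) (<-≤-trans n/m<n n≤k′)
    where
    n/m<n : n / m < n
    n/m<n = m/n<m n m 2≤m
  ...   | r@(suc _) = cong₂ (λ a b → 2 * a + b) (recurse (∸-<-suc n-1 r 0<1+n)) (recurse (∸-<-suc n-1 m 0<m))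
    where
    recurse : ∀ {x} → x < n → spFuel k x m ≡ spFuel k′ x m
    recurse {x} x<n = spFuel-irrelevant x (<-≤-trans x<n n≤k) (<-≤-trans x<n n≤k′)

  sp-< : ∀ n → n < m → sp n m ≡ 1
  sp-< zero _ = refl
  sp-< (suc n) n<m with suc n <? m
  ... | yes _ = refl
  ... | no n≮m = contradiction n<m n≮m

  sp-divisible : ∀ n → m ≤ n → n % m ≡ 0 → sp n m ≡ sp (n / m) m
  sp-divisible zero m≤0 _ = contradiction m≤0 (<⇒≱ 0<m)
  sp-divisible n@(suc _) m≤n n%m≡0 with n <? m
  ... | yes n<m = contradiction m≤n (<⇒≱ n<m)
  ... | no _ with n % m | n%m≡0
  ...   | zero | refl = spFuel-irrelevant (n / m) (m/n<m n m 2≤m) ≤-refl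

  sp-indivisible : ∀ n r → m ≤ n → n % m ≡ suc r → sp n m ≡ 2 * sp (n ∸ suc r) m + sp (n ∸ m) m
  sp-indivisible zero _ m≤0 _ = contradiction m≤0 (<⇒≱ 0<m)
  sp-indivisible n@(suc n-1) r m≤n n%m≡1+r with n <? m
  ... | yes n<m = contradiction m≤n (<⇒≱ n<m)
  ... | no _ with n % m | n%m≡1+r
  ...   | suc _ | refl = cong₂ (λ a b → 2 * a + b)
                           (spFuel-irrelevant (n ∸ suc r) (∸-<-suc n-1 (suc r) 0<1+n) ≤-refl)
                           (spFuel-irrelevant (n ∸ m) (∸-<-suc n-1 m 0<m) ≤-refl)

  sp-m* : ∀ y → sp (m * y) m ≡ sp y m
  sp-m* zero rewrite *-zeroʳ m = refl
  sp-m* y@(suc _) = begin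
    sp (m * y) m        ≡⟨ cong (λ z → sp z m) (*-comm m y) ⟩
    sp (y * m) m        ≡⟨ sp-divisible (y * m) (m≤n*m m y) (m*n%n≡0 y m) ⟩
    sp (y * m / m) m    ≡⟨ cong (λ z → sp z m) (m*n/n≡m y m) ⟩
    sp y m              ∎
    where open ≡-Reasoning

  sp-m^* : ∀ j x → sp (m ^ j * x) m ≡ sp x m
  sp-m^* zero x = cong (λ z → sp z m) (+-identityʳ x)
  sp-m^* (suc j) x = begin
    sp (m * m ^ j * x) m    ≡⟨ cong (λ z → sp z m) (*-assoc m (m ^ j) x) ⟩
    sp (m * (m ^ j * x)) m  ≡⟨ sp-m* (m ^ j * x) ⟩
    sp (m ^ j * x) m        ≡⟨ sp-m^* j x ⟩
    sp x m                  ∎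
    where open ≡-Reasoning

  sp-≤ : ∀ n → n ≤ m → sp n m ≡ 1
  sp-≤ n n≤m with m≤n⇒m<n∨m≡n n≤m
  ... | inj₁ n<m = sp-< n n<m
  ... | inj₂ refl = begin
    sp m m        ≡⟨ cong (λ z → sp z m) (sym (*-identityʳ m)) ⟩
    sp (m * 1) m  ≡⟨ sp-m* 1 ⟩
    sp 1 m        ≡⟨ sp-< 1 2≤m ⟩
    1             ∎
    where open ≡-Reasoning

  sp-m*v+r : ∀ v r → v ≤ m → suc r < m → sp (m * v + suc r) m ≡ 2 * v + 1
  sp-m*v+r zero r _ r<m rewrite *-zeroʳ m = sp-< (suc r) r<m
  sp-m*v+r (suc v) r 1+v≤m r<m = begin
    sp n m                                        ≡⟨ sp-indivisible n r m≤n n%m≡1+r ⟩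
    2 * sp (n ∸ suc r) m + sp (n ∸ m) m           ≡⟨ cong₂ (λ a b → 2 * sp a m + sp b m) n∸r≡m*[1+v] n∸m≡m*v+r ⟩
    2 * sp (m * suc v) m + sp (m * v + suc r) m   ≡⟨ cong₂ (λ a b → 2 * a + b) sp[m*[1+v]]≡1 (sp-m*v+r v r (<⇒≤ 1+v≤m) r<m) ⟩
    2 + (2 * v + 1)                               ≡⟨ sym (+-assoc 2 (2 * v) 1) ⟩
    2 + 2 * v + 1                                 ≡⟨ cong (_+ 1) (sym (*-suc 2 v)) ⟩
    2 * suc v + 1                                 ∎
    where
    open ≡-Reasoning
    n = m * suc v + suc r

    m≤n : m ≤ n
    m≤n = ≤-trans (m≤m*n m (suc v)) (m≤m+n (m * suc v) (suc r))

    n%m≡1+r : n % m ≡ suc r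
    n%m≡1+r = begin
      (m * suc v + suc r) % m  ≡⟨ cong (_% m) (trans (+-comm (m * suc v) (suc r)) (cong (suc r +_) (*-comm m (suc v)))) ⟩
      (suc r + suc v * m) % m  ≡⟨ [m+kn]%n≡m%n (suc r) (suc v) m ⟩
      suc r % m                ≡⟨ m<n⇒m%n≡m r<m ⟩
      suc r                    ∎

    n∸r≡m*[1+v] : n ∸ suc r ≡ m * suc v
    n∸r≡m*[1+v] = m+n∸n≡m (m * suc v) (suc r)

    n∸m≡m*v+r : n ∸ m ≡ m * v + suc r
    n∸m≡m*v+r = begin
      m * suc v + suc r ∸ m    ≡⟨ cong (λ z → z + suc r ∸ m) (*-suc m v) ⟩
      m + m * v + suc r ∸ m    ≡⟨ cong (_∸ m) (+-assoc m (m * v) (suc r)) ⟩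
      m + (m * v + suc r) ∸ m  ≡⟨ m+n∸m≡n m (m * v + suc r) ⟩
      m * v + suc r            ∎

    sp[m*[1+v]]≡1 : sp (m * suc v) m ≡ 1
    sp[m*[1+v]]≡1 = trans (sp-m* (suc v)) (sp-≤ (suc v) 1+v≤m)

corollary3p6 : (m : ℕ) → .{{_ : NonZero m}} → 2 ≤ m →
    (j v r : ℕ) → v ≤ m → 1 ≤ r → r < m →
    sp (m ^ j * (m * v + r)) m ≡ 2 * v + 1
corollary3p6 m 2≤m j v (suc r) v≤m _ r<m =
  trans (sp-m^* j (m * v + suc r)) (sp-m*v+r v r v≤m r<m)
  where open SemiPell m 2≤m
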